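{- Let $(S,\preceq)$ be a finite semilattice and let $(x,\alpha)$ and $(y,\beta)$ be two pseudo-elements in canonical form. Then $\updownarrow(x,\alpha)=\updownarrow(y,\beta)$ if and only if $x=y$ and $\alpha=\beta$.
   Context: $(S,\preceq)$ is a finite partially ordered set in which every two elements $s,s'$ have a greatest lower bound $s\sqcap s'$. For $L\subseteq S$, $\downarrow L=\{s'\in S\mid \exists s\in L,\ s'\preceq s\}$. An antichain is a set of pairwise $\preceq$-incomparable elements. A pseudo-element is a pair $(x,\alpha)$ with $x\in S$ and $\alpha\subseteq S$ an antichain such that $x\notin\downarrow\alpha$; its pseudo-closure is $\updownarrow(x,\alpha)=\downarrow\{x\}\setminus\downarrow\alpha$. A pseudo-element $(x,\alpha)$ is in canonical form if $a\preceq x$ for every $a\in\alpha$. -}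

module Defs where

open import Level using (Level; suc; _⊔_)
open import Data.Bool using (Bool; true; false)
open import Data.List using (List)
open import Data.List.Membership.Propositional using (_∈_)
open import Data.Product using (Σ; ∃; _×_; _,_)
open import Relation.Binary.PropositionalEquality using (_≡_)
open import Relation.Binary.Definitions using (Decidable)
open import Relation.Binary.Structures using (IsPartialOrder)
open import Relation.Nullary using (¬_)

record FiniteSemilattice (c ℓ : Level) : Set (suc (c ⊔ ℓ)) where
  field
    Carrier   : Set c
    _≼_       : Carrier → Carrier → Set ℓ
    isPartialOrder : IsPartialOrder _≡_ _≼_
    elems     : List Carrier
    complete  : ∀ s → s ∈ elems
    -- decidability of equality and order (automatic for a finite poset classically)
    _≟_       : Decidable (_≡_ {A = Carrier})
    _≼?_      : Decidable _≼_
    _⊓_       : Carrier → Carrier → Carrier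
    ⊓-lb₁     : ∀ s t → (s ⊓ t) ≼ s
    ⊓-lb₂     : ∀ s t → (s ⊓ t) ≼ t
    ⊓-greatest : ∀ s t u → u ≼ s → u ≼ t → u ≼ (s ⊓ t)

module _ {c ℓ : Level} (L : FiniteSemilattice c ℓ) where
  open FiniteSemilattice L

  Subset : Set c
  Subset = Carrier → Bool

  _∈ₛ_ : Carrier → Subset → Set
  s ∈ₛ A = A s ≡ true

  _≐_ : Subset → Subset → Set c
  A ≐ B = ∀ s → A s ≡ B s

  _∈↓_ : Carrier → Subset → Set (c ⊔ ℓ)
  s' ∈↓ A = ∃ λ s → s ∈ₛ A × s' ≼ s

  IsAntichain : Subset → Set (c ⊔ ℓ)
  IsAntichain A = ∀ s t → s ∈ₛ A → t ∈ₛ A → s ≼ t → s ≡ t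

  IsPseudoElement : Carrier → Subset → Set (c ⊔ ℓ)
  IsPseudoElement x α = IsAntichain α × ¬ (x ∈↓ α)

  _∈↕_ : Carrier → Carrier × Subset → Set (c ⊔ ℓ)
  s ∈↕ (x , α) = s ≼ x × ¬ (s ∈↓ α)

  IsCanonical : Carrier → Subset → Set (c ⊔ ℓ)
  IsCanonical x α = ∀ a → a ∈ₛ α → a ≼ x

module Submission where

-- Write ↕(x , α) = ↓{x} \ ↓α.  The proof recovers the two components of
-- (x , α) from the set ↕(x , α):
--
--  * the top x: a pseudo-element lies in its own closure, and every element
--    of the closure is below it, so equal closures force x ≼ y and y ≼ x;
--  * the antichain α, once the tops agree: an element a ∈ α is below x
--    (canonical form) but outside ↕(x , α), hence outside ↕(x , β), hence
--    (up to double negation) below some b ∈ β; symmetrically b is below some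
--    a' ∈ α, and a ≼ b ≼ a' inside the antichain α forces a = b ∈ β.
--    Membership in a subset is a Boolean, so the double negation is harmless.

open import Defs
open import Level using (Level)
open import Data.Bool using (true; false)
import Data.Bool.Properties as Bool
open import Data.Product using (_×_; _,_; proj₁)
open import Function.Bundles using (_⇔_; mk⇔; module Equivalence)
open import Relation.Binary.PropositionalEquality using (_≡_; refl; sym; trans; subst)
open import Relation.Binary.Structures using (IsPartialOrder)
open import Relation.Nullary using (¬_)
open import Relation.Nullary.Decidable using (decidable-stable)

open Equivalence using (to; from)

module PseudoClosure {c ℓ : Level} (L : FiniteSemilattice c ℓ) where
  open FiniteSemilattice L using (Carrier; _≼_; isPartialOrder)
  open IsPartialOrder isPartialOrder using (antisym)
    renaming (refl to ≼-refl; trans to ≼-trans)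

  SameClosure : Carrier × Subset L → Carrier × Subset L → Set _
  SameClosure p q = ∀ s → _∈↕_ L s p ⇔ _∈↕_ L s q

  ↕-bounded : ∀ {s x α} → _∈↕_ L s (x , α) → s ≼ x
  ↕-bounded = proj₁

  top-∈↕ : ∀ {x α} → IsPseudoElement L x α → _∈↕_ L x (x , α)
  top-∈↕ (_ , x∉↓α) = ≼-refl , x∉↓α

  top-unique : ∀ {x α y β} → IsPseudoElement L x α → IsPseudoElement L y β
    → SameClosure (x , α) (y , β) → x ≡ y
  top-unique pα pβ same =
    antisym (↕-bounded (to (same _) (top-∈↕ pα)))
            (↕-bounded (from (same _) (top-∈↕ pβ)))

  member-∉↕ : ∀ {a x α} → _∈ₛ_ L a α → ¬ _∈↕_ L a (x , α)
  member-∉↕ a∈α (_ , a∉↓α) = a∉↓α (_ , a∈α , ≼-refl)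

  -- If ↕(x , α) ⊆ ↕(x , β) and β is canonical for x, then each member of β
  -- is (not not) below a member of α: it is below x, yet missing from
  -- ↕(x , β) and therefore from ↕(x , α).
  canonical-member-covered : ∀ {x α β}
    → IsCanonical L x β
    → (∀ s → _∈↕_ L s (x , α) → _∈↕_ L s (x , β))
    → ∀ {b} → _∈ₛ_ L b β → ¬ ¬ (_∈↓_ L b α)
  canonical-member-covered canβ α⊆β b∈β b∉↓α =
    member-∉↕ b∈β (α⊆β _ (canβ _ b∈β , b∉↓α))

  antichain-squeeze : ∀ {α a b a'} → IsAntichain L α
    → _∈ₛ_ L a α → _∈ₛ_ L a' α → a ≼ b → b ≼ a' → a ≡ b
  antichain-squeeze antichain a∈α a'∈α a≼b b≼a'
    with antichain _ _ a∈α a'∈α (≼-trans a≼b b≼a')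
  ... | refl = antisym a≼b b≼a'

  same-top-⊆ : ∀ {x α β} → IsAntichain L α
    → IsCanonical L x α → IsCanonical L x β
    → SameClosure (x , α) (x , β)
    → ∀ a → _∈ₛ_ L a α → _∈ₛ_ L a β
  same-top-⊆ {α = α} {β} antichain canα canβ same a a∈α =
    decidable-stable (β a Bool.≟ true) ¬¬a∈β
    where
    a-covered : ¬ ¬ (_∈↓_ L a β)
    a-covered = canonical-member-covered canα (λ s → from (same s)) a∈α

    b-covered : ∀ {b} → _∈ₛ_ L b β → ¬ ¬ (_∈↓_ L b α)
    b-covered = canonical-member-covered canβ (λ s → to (same s))

    ¬¬a∈β : ¬ ¬ (_∈ₛ_ L a β)
    ¬¬a∈β a∉β = a-covered λ { (b , b∈β , a≼b) →
      b-covered b∈β λ { (a' , a'∈α , b≼a') →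
        a∉β (subst (λ u → _∈ₛ_ L u β)
                   (sym (antichain-squeeze antichain a∈α a'∈α a≼b b≼a')) b∈β) } }

  ⊆-antisym : ∀ {A B : Subset L}
    → (∀ s → _∈ₛ_ L s A → _∈ₛ_ L s B) → (∀ s → _∈ₛ_ L s B → _∈ₛ_ L s A)
    → _≐_ L A B
  ⊆-antisym {A} {B} A⊆B B⊆A s with A s in As | B s in Bs
  ... | true  | _     = trans (sym (A⊆B s As)) Bs
  ... | false | false = refl
  ... | false | true  = trans (sym As) (B⊆A s Bs)

  ↕-injective : ∀ {x α y β}
    → IsPseudoElement L x α → IsCanonical L x α
    → IsPseudoElement L y β → IsCanonical L y β
    → SameClosure (x , α) (y , β) → x ≡ y × _≐_ L α β
  ↕-injective pα canα pβ canβ same with top-unique pα pβ same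
  ... | refl =
    refl , ⊆-antisym (same-top-⊆ (proj₁ pα) canα canβ same)
                     (same-top-⊆ (proj₁ pβ) canβ canα same⁻¹)
    where
    same⁻¹ : SameClosure _ _
    same⁻¹ s = mk⇔ (from (same s)) (to (same s))

  ↕-cong : ∀ {x α y β} → x ≡ y × _≐_ L α β → SameClosure (x , α) (y , β)
  ↕-cong (refl , α≐β) s =
    mk⇔ (restrict α≐β) (restrict (λ t → sym (α≐β t)))
    where
    restrict : ∀ {x} {A B : Subset L} → _≐_ L A B → _∈↕_ L s (x , A) → _∈↕_ L s (x , B)
    restrict A≐B (s≼x , s∉↓A) =
      s≼x , λ { (t , t∈B , s≼t) → s∉↓A (t , trans (A≐B t) t∈B , s≼t) }

corollary1 : {c ℓ : Level} (L : FiniteSemilattice c ℓ)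
    → (x : FiniteSemilattice.Carrier L) (α : Subset L)
    → (y : FiniteSemilattice.Carrier L) (β : Subset L)
    → IsPseudoElement L x α → IsCanonical L x α
    → IsPseudoElement L y β → IsCanonical L y β
    → ((∀ s → (_∈↕_ L s (x , α)) ⇔ (_∈↕_ L s (y , β))) ⇔ (x ≡ y × _≐_ L α β))
corollary1 L x α y β pα canα pβ canβ =
  mk⇔ (↕-injective pα canα pβ canβ) ↕-cong
  where open PseudoClosure L
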